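{- For every $k\geq2$ and every $n\geq1$, the families $\mathrm{SLT}_k$ and $\mathrm{RL}_n^V$ are incomparable, and for every $n\geq1$ the families $\mathrm{SLT}$ and $\mathrm{RL}_n^V$ are incomparable (incomparable meaning neither is a subset of the other).
   Context: A right-linear grammar is $(N,T,P,S)$ with rules of the form $A\to wB$ or $A\to w$, $A,B\in N$, $w\in T^*$; $\mathrm{RL}_n^V$ is the family of regular languages generated by some right-linear grammar with at most $n$ non-terminal symbols. For $k\geq1$, a language $L$ over an alphabet $V$ is strictly locally $k$-testable (family $\mathrm{SLT}_k$) if there are sets $B,I,E\subseteq V^k$ and a finite set $F$ of words of length at most $k-1$ such that $L$ consists of the words of $F$ together with exactly those words $a_1a_2\cdots a_m$ ($m\geq k$, $a_i\in V$) for which $a_1\cdots a_k\in B$, $a_{j+1}\cdots a_{j+k}\in I$ for every $j$ with $1\leq j\leq m-k-1$, and $a_{m-k+1}\cdots a_m\in E$. $\mathrm{SLT}=\bigcup_{k\geq1}\mathrm{SLT}_k$. -}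

module Defs where

open import Data.Nat using (ℕ; _≤_; _<_; _+_; _∸_)
open import Data.Fin using (Fin)
open import Data.List using (List; _++_; length; take; drop)
open import Data.List.Membership.Propositional using (_∈_)
open import Data.List.Relation.Unary.All using (All)
open import Data.Maybe using (Maybe; just; nothing)
open import Data.Product using (Σ; _×_; _,_)
open import Data.Sum using (_⊎_)
open import Relation.Nullary using (¬_)
open import Relation.Binary.PropositionalEquality using (_≡_)
open import Function.Bundles using (_⇔_)

Word : ℕ → Set
Word m = List (Fin m)

Lang : ℕ → Set₁
Lang m = Word m → Set

Family : Set₁
Family = (m : ℕ) → Lang m → Set

_⊆F_ : Family → Family → Set₁
F₁ ⊆F F₂ = ∀ (m : ℕ) (L : Lang m) → F₁ m L → F₂ m L

Incomparable : Family → Family → Set₁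
Incomparable F₁ F₂ = ¬ (F₁ ⊆F F₂) × ¬ (F₂ ⊆F F₁)

-- A rule  A → w B  (target = just B)  or  A → w  (target = nothing),
-- with non-terminals Fin j and terminals Fin m.
record Rule (m j : ℕ) : Set where
  constructor rule
  field
    lhs    : Fin j
    rhs    : Word m
    target : Maybe (Fin j)

record RLG (m j : ℕ) : Set where
  constructor rlg
  field
    rules : List (Rule m j)
    start : Fin j

data Derives {m j : ℕ} (G : RLG m j) : Fin j → Word m → Set where
  term : ∀ {A w} → rule A w nothing ∈ RLG.rules G → Derives G A w
  step : ∀ {A B u v} → rule A u (just B) ∈ RLG.rules G →
         Derives G B v → Derives G A (u ++ v)

LangOf : ∀ {m j} → RLG m j → Lang m
LangOf G w = Derives G (RLG.start G) w

RL : ℕ → Family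
RL n m L = Σ ℕ λ j → j ≤ n × Σ (RLG m j) λ G → ∀ (w : Word m) → L w ⇔ LangOf G w

SLTAccepts : ∀ {m} (k : ℕ) (B I E F : List (Word m)) → Word m → Set
SLTAccepts k B I E F w =
  w ∈ F ⊎
  ( k ≤ length w
  × take k w ∈ B
  × (∀ (j : ℕ) → 1 ≤ j → j + k + 1 ≤ length w → take k (drop j w) ∈ I)
  × drop (length w ∸ k) w ∈ E )

SLT_ : ℕ → Family
(SLT k) m L =
  Σ (List (Word m)) λ B → Σ (List (Word m)) λ I → Σ (List (Word m)) λ E →
  Σ (List (Word m)) λ F →
    All (λ u → length u ≡ k) B × All (λ u → length u ≡ k) I ×
    All (λ u → length u ≡ k) E × All (λ u → length u < k) F ×
    (∀ (w : Word m) → L w ⇔ SLTAccepts k B I E F w)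

SLTall : Family
SLTall m L = Σ ℕ λ k → 1 ≤ k × (SLT k) m L

-- Over a one-letter alphabet all windows of length k coincide, so an SLT_k
-- language containing a long enough word contains all longer ones; hence the
-- even-length language (aa)*, generated by a single non-terminal, is in no
-- SLT_k. Conversely, over n + 1 letters the SLT_k language of constant words
-- c^N (N ≥ k) needs more than n non-terminals: cutting derivations of the
-- words c^N after their first k letters yields, by pigeonhole, two distinct
-- letters a, b whose derivations pass through the same non-terminal, so a
-- word a^X b^Y with X ≥ k and Y ≥ k would be derivable, although its window
-- starting at the last a mixes two letters.
module Submission where

open import Defs
open import Data.Nat using (ℕ; _≤_)
open import Data.Product using (_×_)

open import Data.Nat using (zero; suc; _+_; _*_; _∸_; _<_; z≤n; s≤s)
open import Data.Nat.Properties hiding (<⇒≢)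
open import Data.Fin using (Fin)
open import Data.Fin.Properties using (pigeonhole; <⇒≢)
open import Data.List using (List; []; _∷_; _++_; length; take; drop; replicate; map; allFin)
open import Data.List.Properties using (++-assoc; ++-identityʳ; length-++; length-take; length-drop; length-replicate; ∷-injective)
open import Data.List.Extrema.Nat using (max; xs≤max)
open import Data.List.Membership.Propositional using (_∈_)
open import Data.List.Membership.Propositional.Properties using (∈-map⁺; ∈-map⁻; ∈-allFin)
open import Data.List.Relation.Unary.Any using (here; there)
open import Data.List.Relation.Unary.All as All using (All; []; _∷_)
open import Data.List.Relation.Unary.All.Properties using (take⁺; drop⁺; replicate⁺; ++⁻)
open import Data.Maybe using (just; nothing)
open import Data.Product using (∃; _,_; proj₁; proj₂)
open import Data.Sum using (inj₁; inj₂)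
open import Relation.Nullary using (¬_; contradiction)
open import Relation.Binary.PropositionalEquality
open import Function.Base using (id; _∘_)
open import Function.Bundles using (mk⇔; Equivalence)

module _ {A : Set} where

  length-take-≤ : ∀ {k} {xs : List A} → k ≤ length xs → length (take k xs) ≡ k
  length-take-≤ {k} {xs} k≤ = trans (length-take k xs) (m≤n⇒m⊓n≡m k≤)

  ≤-length-drop : ∀ {k} j (xs : List A) → j + k ≤ length xs → k ≤ length (drop j xs)
  ≤-length-drop zero    xs       j+k≤ = j+k≤
  ≤-length-drop (suc j) (x ∷ xs) (s≤s j+k≤) = ≤-length-drop j xs j+k≤

  length-suffix : ∀ {k} {xs : List A} → k ≤ length xs → length (drop (length xs ∸ k) xs) ≡ k
  length-suffix {k} {xs} k≤ = trans (length-drop (length xs ∸ k) xs) (m∸[m∸n]≡n k≤)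

  All-≡⇒replicate : ∀ {a} {xs : List A} → All (_≡ a) xs → xs ≡ replicate (length xs) a
  All-≡⇒replicate []           = refl
  All-≡⇒replicate (refl ∷ eqs) = cong (_ ∷_) (All-≡⇒replicate eqs)

  drop-replicate-++ : ∀ {a} {ys : List A} p → drop p (replicate (suc p) a ++ ys) ≡ a ∷ ys
  drop-replicate-++ zero    = refl
  drop-replicate-++ (suc p) = drop-replicate-++ p

unary-≡ : {u v : Word 1} → length u ≡ length v → u ≡ v
unary-≡ {[]}         {[]}         _  = refl
unary-≡ {Fin.zero ∷ u} {Fin.zero ∷ v} eq = cong (Fin.zero ∷_) (unary-≡ (suc-injective eq))

∈-unary : ∀ {u v : Word 1} {X} → length u ≡ length v → u ∈ X → v ∈ X
∈-unary {X = X} eq = subst (_∈ X) (unary-≡ eq)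

-- Every window of a unary word of length ≥ k is a^k, and the inner window at
-- position 1 exists by the length assumption.
SLTAccepts-unary-∷ : ∀ {k B I E F} → All (λ u → length u < k) F →
  (w : Word 1) → 1 + k + 1 ≤ length w →
  SLTAccepts k B I E F w → SLTAccepts k B I E F (Fin.zero ∷ w)
SLTAccepts-unary-∷ {k} short w inner≤ (inj₁ w∈F) =
  contradiction (≤-trans (m≤n+m k 1) (≤-trans (m≤m+n (1 + k) 1) inner≤)) (<⇒≱ (All.lookup short w∈F))
SLTAccepts-unary-∷ {k} short w inner≤ (inj₂ (k≤w , prefix , inner , suffix)) =
  inj₂ (k≤w′ , ∈-unary (window≡ k≤w k≤w′) prefix , inner′ , ∈-unary (suffix≡ k≤w k≤w′) suffix)
  where
  k≤w′ : k ≤ length (Fin.zero ∷ w)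
  k≤w′ = ≤-trans k≤w (n≤1+n _)
  window≡ : ∀ {u v : Word 1} → k ≤ length u → k ≤ length v → length (take k u) ≡ length (take k v)
  window≡ k≤u k≤v = trans (length-take-≤ k≤u) (sym (length-take-≤ k≤v))
  suffix≡ : ∀ {u v : Word 1} → k ≤ length u → k ≤ length v →
            length (drop (length u ∸ k) u) ≡ length (drop (length v ∸ k) v)
  suffix≡ k≤u k≤v = trans (length-suffix k≤u) (sym (length-suffix k≤v))
  inner′ : ∀ j → 1 ≤ j → j + k + 1 ≤ length (Fin.zero ∷ w) → take k (drop j (Fin.zero ∷ w)) ∈ _
  inner′ j _ j+k+1≤ =
    ∈-unary (window≡ (≤-length-drop 1 w (≤-trans (m≤m+n (1 + k) 1) inner≤))
                     (≤-length-drop j _ (≤-trans (m≤m+n (j + k) 1) j+k+1≤)))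
            (inner 1 ≤-refl inner≤)

evenG : RLG 1 1
evenG = rlg (rule Fin.zero [] nothing ∷ rule Fin.zero (Fin.zero ∷ Fin.zero ∷ []) (just Fin.zero) ∷ []) Fin.zero

derives-even : ∀ {A w} → Derives evenG A w → ∃ λ r → length w ≡ 2 * r
derives-even (term (here refl))               = 0 , refl
derives-even (term (there (here ())))
derives-even (term (there (there ())))
derives-even (step (here ()) _)
derives-even (step (there (here refl)) d) with r , eq ← derives-even d =
  suc r , trans (cong (2 +_) eq) (sym (*-suc 2 r))
derives-even (step (there (there ())) _)

aa^ : ℕ → Word 1
aa^ zero    = []
aa^ (suc r) = Fin.zero ∷ Fin.zero ∷ aa^ r

derives-aa^ : ∀ r → Derives evenG Fin.zero (aa^ r)
derives-aa^ zero    = term (here refl)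
derives-aa^ (suc r) = step (there (here refl)) (derives-aa^ r)

length-aa^ : ∀ r → length (aa^ r) ≡ 2 * r
length-aa^ zero    = refl
length-aa^ (suc r) = trans (cong (2 +_) (length-aa^ r)) (sym (*-suc 2 r))

evenG∈RL : ∀ n → 1 ≤ n → RL n 1 (LangOf evenG)
evenG∈RL n 1≤n = 1 , 1≤n , evenG , λ _ → mk⇔ id id

evenG∉SLT : ∀ k → ¬ (SLT k) 1 (LangOf evenG)
evenG∉SLT k (B , I , E , F , _ , _ , _ , short , iff) =
  let r , eq = derives-even (Equivalence.from (iff odd) (SLTAccepts-unary-∷ short even inner≤ accepted))
  in  even≢odd r (suc k) (trans (sym eq) (cong suc (length-aa^ (suc k))))
  where
  even odd : Word 1
  even = aa^ (suc k)
  odd  = Fin.zero ∷ even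
  accepted : SLTAccepts k B I E F even
  accepted = Equivalence.to (iff even) (derives-aa^ (suc k))
  inner≤ : 1 + k + 1 ≤ length even
  inner≤ = subst (1 + k + 1 ≤_) (sym (length-aa^ (suc k))) (s≤s (+-monoʳ-≤ k (s≤s z≤n)))

blocks : ∀ m → ℕ → List (Word m)
blocks m k = map (replicate k) (allFin m)

ConstantWords : ∀ m → ℕ → Lang m
ConstantWords m k = SLTAccepts k (blocks m k) (blocks m k) (blocks m k) []

replicate-∈-blocks : ∀ {m} k (c : Fin m) → replicate k c ∈ blocks m k
replicate-∈-blocks k c = ∈-map⁺ (replicate k) (∈-allFin c)

∈-blocks⁻ : ∀ {m k u} → u ∈ blocks m k → ∃ λ c → u ≡ replicate k c
∈-blocks⁻ u∈ with c , _ , eq ← ∈-map⁻ _ u∈ = c , eq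

blocks-length : ∀ m k → All (λ u → length u ≡ k) (blocks m k)
blocks-length m k = All.tabulate λ u∈ → trans (cong length (proj₂ (∈-blocks⁻ u∈))) (length-replicate k)

ConstantWords∈SLT : ∀ m k → (SLT k) m (ConstantWords m k)
ConstantWords∈SLT m k =
  blocks m k , blocks m k , blocks m k , [] ,
  blocks-length m k , blocks-length m k , blocks-length m k , [] , λ _ → mk⇔ id id

constant-∈-blocks : ∀ {m k a} {u : Word m} → All (_≡ a) u → length u ≡ k → u ∈ blocks m k
constant-∈-blocks {m} {k} {a} eqs refl =
  subst (_∈ blocks m k) (sym (All-≡⇒replicate eqs)) (replicate-∈-blocks k a)

constant-∈-ConstantWords : ∀ {m k a} {w : Word m} → All (_≡ a) w → k ≤ length w → ConstantWords m k w
constant-∈-ConstantWords {k = k} {w = w} eqs k≤ =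
  inj₂ ( k≤
       , constant-∈-blocks (take⁺ k eqs) (length-take-≤ k≤)
       , (λ j _ j+k+1≤ → constant-∈-blocks (take⁺ k (drop⁺ j eqs))
                           (length-take-≤ (≤-length-drop j w (≤-trans (m≤m+n (j + k) 1) j+k+1≤))))
       , constant-∈-blocks (drop⁺ (length w ∸ k) eqs) (length-suffix k≤) )

-- The witness is the inner window starting at the last a: it reads a b ….
mixed-∉-ConstantWords : ∀ {m k} {a b : Fin m} {xs ys} → a ≢ b → 2 ≤ k →
  All (_≡ a) xs → 2 ≤ length xs → All (_≡ b) ys → k ≤ length ys →
  ¬ ConstantWords m k (xs ++ ys)
mixed-∉-ConstantWords {m} {k} {a} {b} {xs} {ys} a≢b 2≤k xs≡a 2≤xs ys≡b k≤ys accepted =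
  replicate-++-∉ 2≤k ys≡b 2≤xs k≤ys (subst (λ v → ConstantWords m k (v ++ ys)) (All-≡⇒replicate xs≡a) accepted)
  where
  replicate-++-∉ : ∀ {k X ys} → 2 ≤ k → All (_≡ b) ys → 2 ≤ X → k ≤ length ys →
                   ¬ ConstantWords m k (replicate X a ++ ys)
  replicate-++-∉ {k} {ys = ys} (s≤s (s≤s _)) (refl ∷ _) (s≤s (s≤s {n = p} _)) k≤ys (inj₂ (_ , _ , inner , _)) =
    a≢b (trans a≡c (sym b≡c))
    where
    open ≤-Reasoning
    w = replicate (2 + p) a ++ ys
    bound : suc p + k + 1 ≤ length w
    bound = begin
      suc p + k + 1                                ≡⟨ +-assoc (suc p) k 1 ⟩
      suc p + (k + 1)                              ≡⟨ cong (suc p +_) (+-comm k 1) ⟩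
      suc p + suc k                                ≡⟨ +-suc (suc p) k ⟩
      suc (suc p + k)                              ≤⟨ s≤s (+-monoʳ-≤ (suc p) k≤ys) ⟩
      2 + p + length (ys)                     ≡⟨ cong (_+ length (ys)) (sym (length-replicate (2 + p))) ⟩
      length (replicate (2 + p) a) + length (ys) ≡⟨ sym (length-++ (replicate (2 + p) a)) ⟩
      length w                                     ∎
    window = ∈-blocks⁻ (subst (λ v → take k v ∈ blocks m k) (drop-replicate-++ (suc p)) (inner (suc p) (s≤s z≤n) bound))
    a≡c = proj₁ (∷-injective (proj₂ window))
    b≡c = proj₁ (∷-injective (proj₂ (∷-injective (proj₂ window))))
  replicate-++-∉ _ _ _ _ (inj₁ ())

module Cutting {m j : ℕ} (G : RLG m j) where

  data Reaches : Fin j → Word m → Fin j → Set where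
    done : ∀ {A} → Reaches A [] A
    next : ∀ {A B C u x} → rule A u (just B) ∈ RLG.rules G → Reaches B x C → Reaches A (u ++ x) C

  reaches-one : ∀ {A B u} → rule A u (just B) ∈ RLG.rules G → Reaches A u B
  reaches-one {A} {B} {u} r = subst (λ x → Reaches A x B) (++-identityʳ u) (next r done)

  reaches-derives : ∀ {A B x y} → Reaches A x B → Derives G B y → Derives G A (x ++ y)
  reaches-derives done d = d
  reaches-derives {A} {y = y} (next {u = u} {x = x} r rx) d =
    subst (Derives G A) (sym (++-assoc u x y)) (step r (reaches-derives rx d))

  rhsBound : ℕ
  rhsBound = max 0 (map (length ∘ Rule.rhs) (RLG.rules G))

  rhs≤rhsBound : ∀ {r} → r ∈ RLG.rules G → length (Rule.rhs r) ≤ rhsBound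
  rhs≤rhsBound r∈ = All.lookup (xs≤max 0 _) (∈-map⁺ (length ∘ Rule.rhs) r∈)

  record Cut (A : Fin j) (w : Word m) (t : ℕ) : Set where
    field
      via     : Fin j
      prefix  : Word m
      suffix  : Word m
      reaches : Reaches A prefix via
      derives : Derives G via suffix
      splits  : w ≡ prefix ++ suffix
      long    : t ≤ length prefix
      short   : length prefix ≤ t + rhsBound

  -- Each step reads at most rhsBound letters, so the first step that passes
  -- position t stops before t + rhsBound.
  cut : ∀ {A w} → Derives G A w → ∀ t → t + rhsBound ≤ length w → Cut A w t
  cut {A} {w} d zero _ = record
    { via = A ; prefix = [] ; suffix = w ; reaches = done ; derives = d
    ; splits = refl ; long = z≤n ; short = z≤n }
  cut (term r) (suc t) t+M≤w =
    contradiction (≤-trans t+M≤w (rhs≤rhsBound r)) (<⇒≱ (s≤s (m≤n+m rhsBound t)))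
  cut (step {B = B} {u} {v} r d) t t+M≤w with ≤-total t (length u)
  ... | inj₁ t≤u = record
    { via = B ; prefix = u ; suffix = v ; reaches = reaches-one r ; derives = d
    ; splits = refl ; long = t≤u ; short = ≤-trans (rhs≤rhsBound r) (m≤n+m rhsBound t) }
  ... | inj₂ u≤t with t′ , refl ← m≤n⇒∃[o]m+o≡n u≤t = record
    { via = Cut.via c ; prefix = u ++ Cut.prefix c ; suffix = Cut.suffix c
    ; reaches = next r (Cut.reaches c) ; derives = Cut.derives c
    ; splits = trans (cong (u ++_) (Cut.splits c)) (sym (++-assoc u (Cut.prefix c) (Cut.suffix c)))
    ; long = subst (length u + t′ ≤_) (sym (length-++ u)) (+-monoʳ-≤ (length u) (Cut.long c))
    ; short = begin
        length (u ++ Cut.prefix c)        ≡⟨ length-++ u ⟩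
        length u + length (Cut.prefix c)  ≤⟨ +-monoʳ-≤ (length u) (Cut.short c) ⟩
        length u + (t′ + rhsBound)        ≡⟨ +-assoc (length u) t′ rhsBound ⟨
        length u + t′ + rhsBound          ∎ }
    where
    open ≤-Reasoning
    t′+M≤v : t′ + rhsBound ≤ length v
    t′+M≤v = +-cancelˡ-≤ (length u) _ _
               (subst₂ _≤_ (+-assoc (length u) t′ rhsBound) (length-++ u) t+M≤w)
    c : Cut B v t′
    c = cut d t′ t′+M≤v

  suffix-long : ∀ {A w t s} (c : Cut A w t) → t + rhsBound + s ≤ length w → s ≤ length (Cut.suffix c)
  suffix-long {w = w} {t} {s} c t+M+s≤w = +-cancelˡ-≤ (t + rhsBound) s _ (begin
    t + rhsBound + s                                  ≤⟨ t+M+s≤w ⟩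
    length w                                          ≡⟨ cong length (Cut.splits c) ⟩
    length (Cut.prefix c ++ Cut.suffix c)             ≡⟨ length-++ (Cut.prefix c) ⟩
    length (Cut.prefix c) + length (Cut.suffix c)     ≤⟨ +-monoˡ-≤ _ (Cut.short c) ⟩
    t + rhsBound + length (Cut.suffix c)              ∎)
    where open ≤-Reasoning

ConstantWords∉RL : ∀ n k → 2 ≤ k → ¬ RL n (suc n) (ConstantWords (suc n) k)
ConstantWords∉RL n k 2≤k (j , j≤n , G , iff) =
  let i , i′ , i<i′ , same-via = pigeonhole (s≤s j≤n) (Cut.via ∘ cutAt)
      mixed = reaches-derives (Cut.reaches (cutAt i))
                (subst (λ B → Derives G B (Cut.suffix (cutAt i′))) (sym same-via) (Cut.derives (cutAt i′)))
  in  mixed-∉-ConstantWords (<⇒≢ i<i′) 2≤k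
        (proj₁ (pieces i)) (≤-trans 2≤k (Cut.long (cutAt i)))
        (proj₂ (pieces i′)) (suffix-long (cutAt i′) (N≤ i′))
        (Equivalence.from (iff _) mixed)
  where
  open Cutting G
  N : ℕ
  N = k + rhsBound + k
  N≤ : ∀ c → N ≤ length (replicate N c)
  N≤ c = ≤-reflexive (sym (length-replicate N))
  cutAt : (c : Fin (suc n)) → Cut (RLG.start G) (replicate N c) k
  cutAt c = cut (Equivalence.to (iff _) (constant-∈-ConstantWords (replicate⁺ N refl) (≤-trans (m≤n+m k (k + rhsBound)) (N≤ c))))
                k (≤-trans (m≤m+n (k + rhsBound) k) (N≤ c))
  pieces : ∀ c → All (_≡ c) (Cut.prefix (cutAt c)) × All (_≡ c) (Cut.suffix (cutAt c))
  pieces c = ++⁻ _ (subst (All (_≡ c)) (Cut.splits (cutAt c)) (replicate⁺ N refl))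

lemma16 : (∀ (k n : ℕ) → 2 ≤ k → 1 ≤ n → Incomparable (SLT k) (RL n))
        × (∀ (n : ℕ) → 1 ≤ n → Incomparable SLTall (RL n))
lemma16 = SLT_k-incomparable , SLT-incomparable
  where
  SLT_k-incomparable : ∀ k n → 2 ≤ k → 1 ≤ n → Incomparable (SLT k) (RL n)
  SLT_k-incomparable k n 2≤k 1≤n =
    (λ SLT⊆RL → ConstantWords∉RL n k 2≤k (SLT⊆RL (suc n) _ (ConstantWords∈SLT (suc n) k))) ,
    (λ RL⊆SLT → evenG∉SLT k (RL⊆SLT 1 _ (evenG∈RL n 1≤n)))
  SLT-incomparable : ∀ n → 1 ≤ n → Incomparable SLTall (RL n)
  SLT-incomparable n 1≤n =
    (λ SLT⊆RL → ConstantWords∉RL n 2 ≤-refl (SLT⊆RL (suc n) _ (2 , s≤s z≤n , ConstantWords∈SLT (suc n) 2))) ,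
    (λ RL⊆SLT → let k , _ , evenG∈SLT = RL⊆SLT 1 _ (evenG∈RL n 1≤n) in evenG∉SLT k evenG∈SLT)
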